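{- Let $\varphi(x)=\sum_{i=0}^r a_i\binom{x}{i}$ with $a_i\in\mathbb{Z}$ and $a_r>0$. Then there are $b_0,\dots,b_r\in\mathbb{N}$ and $c_0,\dots,c_r\in\mathbb{N}$ with $\varphi(x)=\sum_{i=0}^r b_i\binom{x-c_i}{i}$ as polynomials.
   Context: $\mathbb{N}=\{0,1,2,\dots\}$. For $i\in\mathbb{N}$, $\binom{x}{i}$ denotes the polynomial $\frac{1}{i!}x(x-1)\cdots(x-i+1)\in\mathbb{Q}[x]$. -}

module Defs where

open import Data.Nat as ℕ using (ℕ; zero; suc)
open import Data.Integer as ℤ using (ℤ; +_)
open import Data.Rational using (ℚ; 0ℚ; 1ℚ; _+_; _*_; _-_; _/_)
open import Data.Fin using (Fin; zero; suc)

ℕtoℚ : ℕ → ℚ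
ℕtoℚ n = (+ n) / 1

ℤtoℚ : ℤ → ℚ
ℤtoℚ z = z / 1

binom : ℚ → ℕ → ℚ
binom x zero    = 1ℚ
binom x (suc i) = binom x i * ((x - ℕtoℚ i) * ((+ 1) / suc i))

sumFin : (n : ℕ) → (Fin n → ℚ) → ℚ
sumFin zero    f = 0ℚ
sumFin (suc n) f = f zero + sumFin n (λ i → f (suc i))

{-# OPTIONS --safe #-}
module Submission where

-- By Pascal's rule C(y + 1, i) = C(y, i) + C(y, i - 1), if φ(x) = Σ a_i C(x, i) then
-- φ(y + 1) = Σ (a_i + a_{i+1}) C(y, i): substituting x = y + 1 keeps the leading
-- coefficient a_r and adds it to a_{r-1}. Since a_r > 0, after finitely many such
-- substitutions a_{r-1} is positive, so a_r C(x - c, r) can be split off and the rest,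
-- of degree r - 1 with positive leading coefficient, is handled by induction.

open import Defs
open import Function using (_∘_)
open import Data.Nat as ℕ using (ℕ; zero; suc)
import Data.Nat.Properties as ℕ
open import Data.Integer as ℤ using (ℤ; +_; -[1+_]; 0ℤ; ∣_∣; -<+; -<-) renaming (_<_ to _<ℤ_)
import Data.Integer.Properties as ℤ
open import Data.Nat.Coprimality as Coprime using (1-coprimeTo)
open import Data.Rational using (ℚ; mkℚ; 0ℚ; 1ℚ; _+_; _*_; _-_; _/_; 1/_)
import Data.Rational.Properties as ℚ
open import Data.Rational.Solver using (module +-*-Solver)
open import Data.Fin using (Fin; zero; suc; toℕ; fromℕ; inject₁; opposite)
import Data.Fin.Properties as Fin
open import Data.Vec using (Vec; []; _∷_; head; lookup; tabulate; map)
import Data.Vec.Properties as Vec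
open import Data.Product using (Σ; _×_; _,_; proj₁; proj₂; map₂)
open import Relation.Binary.PropositionalEquality
open ≡-Reasoning
open +-*-Solver

ℤtoℚ≡mkℚ : ∀ i → ℤtoℚ i ≡ mkℚ i 0 (Coprime.sym (1-coprimeTo ∣ i ∣))
ℤtoℚ≡mkℚ i = ℚ.↥p/↧p≡p (mkℚ i 0 _)

ℤtoℚ-+ : ∀ i j → ℤtoℚ (i ℤ.+ j) ≡ ℤtoℚ i + ℤtoℚ j
ℤtoℚ-+ i j = begin
  ℤtoℚ (i ℤ.+ j)                    ≡⟨ cong ℤtoℚ (cong₂ ℤ._+_ (ℤ.*-identityʳ i) (ℤ.*-identityʳ j)) ⟨
  -- the sum of two fractions with denominator 1 computes to the left-hand side
  ℤtoℚ (i ℤ.* + 1 ℤ.+ j ℤ.* + 1)    ≡⟨ cong₂ _+_ (ℤtoℚ≡mkℚ i) (ℤtoℚ≡mkℚ j) ⟨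
  ℤtoℚ i + ℤtoℚ j                    ∎

ℕtoℚ-suc : ∀ n → ℕtoℚ (suc n) ≡ 1ℚ + ℕtoℚ n
ℕtoℚ-suc n = ℤtoℚ-+ (+ 1) (+ n)

1/[1+_] : ℕ → ℚ
1/[1+ n ] = + 1 / suc n

1/[1+n]*[1+n] : ∀ n → 1/[1+ n ] * (1ℚ + ℕtoℚ n) ≡ 1ℚ
1/[1+n]*[1+n] n = begin
  1/[1+ n ] * (1ℚ + ℕtoℚ n)
    ≡⟨ cong₂ _*_ (ℚ.normalize-coprime (1-coprimeTo (suc n))) (trans (sym (ℕtoℚ-suc n)) (ℤtoℚ≡mkℚ (+ suc n))) ⟩
  1/ p * p
    ≡⟨ ℚ.*-inverseˡ p ⟩
  1ℚ
    ∎
  where p = mkℚ (+ suc n) 0 (Coprime.sym (1-coprimeTo (suc n)))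

1/[1+n]-split : ∀ n → 1/[1+ n ] * 1/[1+ suc n ] + 1/[1+ suc n ] ≡ 1/[1+ n ]
1/[1+n]-split n = begin
  u * v + v                               ≡⟨ solve 2 (λ u v → u :* v :+ v := u :* v :+ v :* con 1ℚ) refl u v ⟩
  u * v + v * 1ℚ                          ≡⟨ cong (λ t → u * v + v * t) (1/[1+n]*[1+n] n) ⟨
  u * v + v * (u * (1ℚ + m))              ≡⟨ solve 3 (λ u v m → u :* v :+ v :* (u :* (con 1ℚ :+ m))
                                                        := u :* (v :* (con 1ℚ :+ (con 1ℚ :+ m)))) refl u v m ⟩
  u * (v * (1ℚ + (1ℚ + m)))               ≡⟨ cong (λ t → u * (v * (1ℚ + t))) (ℕtoℚ-suc n) ⟨
  u * (v * (1ℚ + ℕtoℚ (suc n)))           ≡⟨ cong (u *_) (1/[1+n]*[1+n] (suc n)) ⟩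
  u * 1ℚ                                  ≡⟨ ℚ.*-identityʳ u ⟩
  u                                       ∎
  where
  u = 1/[1+ n ]
  v = 1/[1+ suc n ]
  m = ℕtoℚ n

pascal : ∀ y i → binom y (suc i) ≡ binom (y - 1ℚ) (suc i) + binom (y - 1ℚ) i
pascal y zero    = solve 1 (λ y → con 1ℚ :* ((y :- con 0ℚ) :* con 1ℚ)
                                 := con 1ℚ :* (((y :- con 1ℚ) :- con 0ℚ) :* con 1ℚ) :+ con 1ℚ) refl y
pascal y (suc i) = begin
  binom y (suc i) * ((y - ℕtoℚ (suc i)) * v)
    ≡⟨ cong₂ (λ b k → b * ((y - k) * v)) (pascal y i) (ℕtoℚ-suc i) ⟩
  (p * (w * u) + p) * ((y - (1ℚ + m)) * v)
    ≡⟨ solve 5 (λ p y m u v → (p :* (((y :- con 1ℚ) :- m) :* u) :+ p) :* ((y :- (con 1ℚ :+ m)) :* v)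
                := p :* (((y :- con 1ℚ) :- m) :* u) :* (((y :- con 1ℚ) :- (con 1ℚ :+ m)) :* v)
                   :+ p :* ((y :- con 1ℚ) :- m) :* (u :* v :+ v)) refl p y m u v ⟩
  p * (w * u) * (((y - 1ℚ) - (1ℚ + m)) * v) + p * w * (u * v + v)
    ≡⟨ cong (λ t → p * (w * u) * (((y - 1ℚ) - (1ℚ + m)) * v) + p * w * t) (1/[1+n]-split i) ⟩
  p * (w * u) * (((y - 1ℚ) - (1ℚ + m)) * v) + p * w * u
    ≡⟨ cong₂ (λ k t → p * (w * u) * (((y - 1ℚ) - k) * v) + t) (ℕtoℚ-suc i) (sym (ℚ.*-assoc p w u)) ⟨
  binom (y - 1ℚ) (suc (suc i)) + binom (y - 1ℚ) (suc i)
    ∎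
  where
  p = binom (y - 1ℚ) i
  m = ℕtoℚ i
  w = (y - 1ℚ) - m
  u = 1/[1+ i ]
  v = 1/[1+ suc i ]

-- Coefficient vectors list the top degree first, so that induction peels off the leading term.
Σ↓ : {A : Set} {n : ℕ} → Vec A n → (A → ℕ → ℚ) → ℚ
Σ↓ []                   t = 0ℚ
Σ↓ {n = suc n} (a ∷ as) t = t a n + Σ↓ as t

sumFin-cong : ∀ n {f g : Fin n → ℚ} → (∀ i → f i ≡ g i) → sumFin n f ≡ sumFin n g
sumFin-cong zero    f≗g = refl
sumFin-cong (suc n) f≗g = cong₂ _+_ (f≗g zero) (sumFin-cong n (f≗g ∘ suc))

sumFin-fromℕ : ∀ n (f : Fin (suc n) → ℚ) → sumFin (suc n) f ≡ f (fromℕ n) + sumFin n (f ∘ inject₁)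
sumFin-fromℕ zero    f = refl
sumFin-fromℕ (suc n) f = begin
  f zero + sumFin (suc n) (f ∘ suc)                         ≡⟨ cong (λ s → f zero + s) (sumFin-fromℕ n (f ∘ suc)) ⟩
  f zero + (f (fromℕ (suc n)) + sumFin n (f ∘ suc ∘ inject₁)) ≡⟨ solve 3 (λ a b s → a :+ (b :+ s) := b :+ (a :+ s))
                                                                   refl (f zero) (f (fromℕ (suc n))) _ ⟩
  f (fromℕ (suc n)) + sumFin (suc n) (f ∘ inject₁)          ∎

opposite-fromℕ : ∀ n → opposite (fromℕ n) ≡ zero
opposite-fromℕ zero    = refl
opposite-fromℕ (suc n) = cong inject₁ (opposite-fromℕ n)

opposite-inject₁ : ∀ {n} (i : Fin n) → opposite (inject₁ i) ≡ suc (opposite i)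
opposite-inject₁ zero    = refl
opposite-inject₁ (suc i) = cong inject₁ (opposite-inject₁ i)

sumFin≡Σ↓ : {A : Set} {n : ℕ} (v : Vec A n) (t : A → ℕ → ℚ) →
  sumFin n (λ i → t (lookup v (opposite i)) (toℕ i)) ≡ Σ↓ v t
sumFin≡Σ↓ []                   t = refl
sumFin≡Σ↓ {n = suc n} (a ∷ as) t = begin
  sumFin (suc n) g                      ≡⟨ sumFin-fromℕ n g ⟩
  g (fromℕ n) + sumFin n (g ∘ inject₁)  ≡⟨ cong₂ _+_ leading lower ⟩
  t a n + Σ↓ as t                       ∎
  where
  g : Fin (suc n) → ℚ
  g i = t (lookup (a ∷ as) (opposite i)) (toℕ i)
  leading : g (fromℕ n) ≡ t a n
  leading = cong₂ (λ j k → t (lookup (a ∷ as) j) k) (opposite-fromℕ n) (Fin.toℕ-fromℕ n)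
  lower : sumFin n (g ∘ inject₁) ≡ Σ↓ as t
  lower = trans (sumFin-cong n λ i → cong₂ (λ j k → t (lookup (a ∷ as) j) k) (opposite-inject₁ i) (Fin.toℕ-inject₁ i))
                (sumFin≡Σ↓ as t)

newtonTerm : ℚ → ℤ → ℕ → ℚ
newtonTerm x a k = ℤtoℚ a * binom x k

shiftedTerm : ℚ → ℕ × ℕ → ℕ → ℚ
shiftedTerm x bc k = ℕtoℚ (proj₁ bc) * binom (x - ℕtoℚ (proj₂ bc)) k

carry : {n : ℕ} → ℤ → Vec ℤ n → Vec ℤ n
carry p []       = []
carry p (a ∷ as) = a ℤ.+ p ∷ carry a as

shift : {n : ℕ} → Vec ℤ n → Vec ℤ n
shift []       = []
shift (a ∷ as) = a ∷ carry a as

Σ↓-shift : {n : ℕ} (v : Vec ℤ n) (y : ℚ) → Σ↓ (shift v) (newtonTerm (y - 1ℚ)) ≡ Σ↓ v (newtonTerm y)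
Σ↓-shift []                           y = refl
Σ↓-shift (a ∷ [])                     y = refl
Σ↓-shift {suc (suc n)} (a ∷ b ∷ bs) y = begin
  A * binom (y - 1ℚ) (suc n) + (ℤtoℚ (b ℤ.+ a) * binom (y - 1ℚ) n + R)
    ≡⟨ cong (λ t → A * binom (y - 1ℚ) (suc n) + (t * binom (y - 1ℚ) n + R)) (ℤtoℚ-+ b a) ⟩
  A * binom (y - 1ℚ) (suc n) + ((B + A) * binom (y - 1ℚ) n + R)
    ≡⟨ solve 5 (λ A B C₁ C₀ R → A :* C₁ :+ ((B :+ A) :* C₀ :+ R) := A :* (C₁ :+ C₀) :+ (B :* C₀ :+ R))
         refl A B (binom (y - 1ℚ) (suc n)) (binom (y - 1ℚ) n) R ⟩
  A * (binom (y - 1ℚ) (suc n) + binom (y - 1ℚ) n) + Σ↓ (shift (b ∷ bs)) (newtonTerm (y - 1ℚ))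
    ≡⟨ cong₂ (λ s t → A * s + t) (sym (pascal y n)) (Σ↓-shift (b ∷ bs) y) ⟩
  A * binom y (suc n) + Σ↓ (b ∷ bs) (newtonTerm y)
    ∎
  where
  A = ℤtoℚ a
  B = ℤtoℚ b
  R = Σ↓ (carry b bs) (newtonTerm (y - 1ℚ))

Representable : {n : ℕ} → Vec ℤ n → Set
Representable {n} v = Σ (Vec (ℕ × ℕ) n) λ bc → ∀ x → Σ↓ v (newtonTerm x) ≡ Σ↓ bc (shiftedTerm x)

representable-[] : Representable []
representable-[] = [] , λ _ → refl

representable-∷ : {n : ℕ} {a : ℤ} {as : Vec ℤ n} → 0ℤ ℤ.≤ a → Representable as → Representable (a ∷ as)
representable-∷ {n} {a} 0≤a (bc , eq) = (∣ a ∣ , 0) ∷ bc , λ x → cong₂ _+_ (leading x) (eq x)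
  where
  leading : ∀ x → ℤtoℚ a * binom x n ≡ ℕtoℚ ∣ a ∣ * binom (x - ℕtoℚ 0) n
  leading x = cong₂ (λ i y → ℤtoℚ i * binom y n) (sym (ℤ.0≤i⇒+∣i∣≡i 0≤a)) (sym (ℚ.+-identityʳ x))

x-1-c≡x-[1+c] : ∀ x c → (x - 1ℚ) - ℕtoℚ c ≡ x - ℕtoℚ (suc c)
x-1-c≡x-[1+c] x c = begin
  (x - 1ℚ) - ℕtoℚ c    ≡⟨ solve 2 (λ x c → (x :- con 1ℚ) :- c := x :- (con 1ℚ :+ c)) refl x (ℕtoℚ c) ⟩
  x - (1ℚ + ℕtoℚ c)    ≡⟨ cong (x -_) (ℕtoℚ-suc c) ⟨
  x - ℕtoℚ (suc c)     ∎

Σ↓-shiftedTerm-x-1 : {n : ℕ} (bc : Vec (ℕ × ℕ) n) (x : ℚ) →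
  Σ↓ bc (shiftedTerm (x - 1ℚ)) ≡ Σ↓ (map (map₂ suc) bc) (shiftedTerm x)
Σ↓-shiftedTerm-x-1 []                          x = refl
Σ↓-shiftedTerm-x-1 {suc n} ((b , c) ∷ bc) x =
  cong₂ _+_ (cong (λ y → ℕtoℚ b * binom y n) (x-1-c≡x-[1+c] x c)) (Σ↓-shiftedTerm-x-1 bc x)

representable-shift : {n : ℕ} {v : Vec ℤ n} → Representable (shift v) → Representable v
representable-shift {v = v} (bc , eq) = map (map₂ suc) bc , λ x → begin
  Σ↓ v (newtonTerm x)                       ≡⟨ Σ↓-shift v x ⟨
  Σ↓ (shift v) (newtonTerm (x - 1ℚ))        ≡⟨ eq (x - 1ℚ) ⟩
  Σ↓ bc (shiftedTerm (x - 1ℚ))              ≡⟨ Σ↓-shiftedTerm-x-1 bc x ⟩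
  Σ↓ (map (map₂ suc) bc) (shiftedTerm x)    ∎

-[1+∣i∣]<i : ∀ i → -[1+ ∣ i ∣ ] <ℤ i
-[1+∣i∣]<i (+ n)    = -<+
-[1+∣i∣]<i -[1+ n ] = -<- (ℕ.n<1+n n)

-[1+m]<i⇒-m<i+j : ∀ m {i j} → -[1+ m ] <ℤ i → 0ℤ <ℤ j → ℤ.- (+ m) <ℤ i ℤ.+ j
-[1+m]<i⇒-m<i+j m {i} {j} -[1+m]<i 0<j =
  ℤ.≤-<-trans -m≤i (subst (_<ℤ i ℤ.+ j) (ℤ.+-identityʳ i) (ℤ.+-monoʳ-< i 0<j))
  where
  -m≤i : ℤ.- (+ m) ℤ.≤ i
  -m≤i = subst (ℤ._≤ i) (trans (cong ℤ.suc (ℤ.neg-suc m)) (ℤ.suc-pred _)) (ℤ.i<j⇒suc[i]≤j -[1+m]<i)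

representable : {n : ℕ} (v : Vec ℤ (suc n)) → 0ℤ <ℤ head v → Representable v
representable (a ∷ [])          0<a = representable-∷ {as = []} (ℤ.<⇒≤ 0<a) representable-[]
representable {suc n} (a ∷ b ∷ bs) 0<a = raise (suc ∣ b ∣) b bs (-[1+∣i∣]<i b)
  where
  -- each shift adds a > 0 to b, so m shifts suffice
  raise : ∀ m b (bs : Vec ℤ n) → ℤ.- (+ m) <ℤ b → Representable (a ∷ b ∷ bs)
  raise zero    b bs 0<b    = representable-∷ {as = b ∷ bs} (ℤ.<⇒≤ 0<a) (representable (b ∷ bs) 0<b)
  raise (suc m) b bs -m-1<b =
    representable-shift {v = a ∷ b ∷ bs} (raise m (b ℤ.+ a) (carry b bs) (-[1+m]<i⇒-m<i+j m -m-1<b 0<a))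

lemma19 : (r : ℕ) (a : Fin (suc r) → ℤ) → 0ℤ <ℤ a (fromℕ r) →
    Σ (Fin (suc r) → ℕ) λ b → Σ (Fin (suc r) → ℕ) λ c →
      (x : ℚ) →
        sumFin (suc r) (λ i → ℤtoℚ (a i) * binom x (toℕ i))
          ≡ sumFin (suc r) (λ i → ℕtoℚ (b i) * binom (x - ℕtoℚ (c i)) (toℕ i))
lemma19 r a 0<aᵣ =
  let (bc , eq) = representable v 0<aᵣ in
  proj₁ ∘ lookup bc ∘ opposite , proj₂ ∘ lookup bc ∘ opposite , λ x → begin
    sumFin (suc r) (λ i → newtonTerm x (a i) (toℕ i))
      ≡⟨ sumFin-cong (suc r) (λ i → cong (λ j → newtonTerm x j (toℕ i)) (coefficient i)) ⟩
    sumFin (suc r) (λ i → newtonTerm x (lookup v (opposite i)) (toℕ i))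
      ≡⟨ sumFin≡Σ↓ v (newtonTerm x) ⟩
    Σ↓ v (newtonTerm x)
      ≡⟨ eq x ⟩
    Σ↓ bc (shiftedTerm x)
      ≡⟨ sumFin≡Σ↓ bc (shiftedTerm x) ⟨
    sumFin (suc r) (λ i → shiftedTerm x (lookup bc (opposite i)) (toℕ i))
      ∎
  where
  v : Vec ℤ (suc r)
  v = tabulate (a ∘ opposite)
  coefficient : ∀ i → a i ≡ lookup v (opposite i)
  coefficient i =
    sym (trans (Vec.lookup∘tabulate (a ∘ opposite) (opposite i)) (cong a (Fin.opposite-involutive i)))
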